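{- Let $q$ be a power of an odd prime, let $F,H,K,R\in\mathbb{F}_q[T]$ be monic with $F\mid R$, and let $z$ be a non-negative integer with $z<\deg(R)$. Then \[ \sum_{\substack{A,B \text{ monic}\\ \deg(AB)=z\\ AH\equiv BK \ (\mathrm{mod}\ F)\\ AH\neq BK\\ (ABHK,R)=1}}\frac{1}{|AB|^{\frac{1}{2}}}\ll\frac{q^{\frac{z}{2}}(z+1)|HK|}{|F|}. \]
   Context: For $f\in\mathbb{F}_q[T]$, $|f|=q^{\deg(f)}$; $(\cdot,\cdot)$ denotes the monic gcd. -}

module Defs where

open import Data.Nat as ℕ using (ℕ; zero; suc; _∸_; _≤_)
open import Data.Fin using (Fin)
open import Data.List using (List; []; _∷_; _++_; [_]; length)
open import Data.Vec using (Vec; toList)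
open import Data.Product using (Σ; ∃; _×_; _,_)
open import Data.Empty using (⊥)
open import Relation.Nullary using (¬_)
open import Relation.Binary.PropositionalEquality using (_≡_)
open import Algebra.Structures using (IsCommutativeRing)
open import Level using (0ℓ)

-- A finite field with q elements, realised on the carrier Fin q
-- (every finite field of order q is isomorphic to one of these),
-- with propositional equality.
record FiniteField (q : ℕ) : Set where
  field
    _+_ _*_ : Fin q → Fin q → Fin q
    -_      : Fin q → Fin q
    0# 1#   : Fin q
    isCommutativeRing : IsCommutativeRing _≡_ _+_ _*_ -_ 0# 1#
    0≢1     : ¬ (0# ≡ 1#)
    inverse : ∀ x → ¬ (x ≡ 0#) → ∃ λ y → x * y ≡ 1#

module Poly {q : ℕ} (𝔽 : FiniteField q) where
  open FiniteField 𝔽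

  K : Set
  K = Fin q

  -- Polynomials in 𝔽[T] as coefficient lists, constant term first;
  -- trailing zero coefficients are allowed and ignored by _≈ₚ_.
  Pol : Set
  Pol = List K

  IsZero : Pol → Set
  IsZero []       = Data.Unit.⊤ where import Data.Unit
  IsZero (c ∷ cs) = (c ≡ 0#) × IsZero cs

  _+ₚ_ : Pol → Pol → Pol
  []       +ₚ g        = g
  (a ∷ f)  +ₚ []       = a ∷ f
  (a ∷ f)  +ₚ (b ∷ g)  = (a + b) ∷ (f +ₚ g)

  negₚ : Pol → Pol
  negₚ []      = []
  negₚ (a ∷ f) = (- a) ∷ negₚ f

  _-ₚ_ : Pol → Pol → Pol
  f -ₚ g = f +ₚ negₚ g

  scale : K → Pol → Pol
  scale c []      = []
  scale c (a ∷ f) = (c * a) ∷ scale c f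

  _*ₚ_ : Pol → Pol → Pol
  []      *ₚ g = []
  (a ∷ f) *ₚ g = scale a g +ₚ (0# ∷ (f *ₚ g))

  oneₚ : Pol
  oneₚ = 1# ∷ []

  _≈ₚ_ : Pol → Pol → Set
  f ≈ₚ g = IsZero (f -ₚ g)

  _∣ₚ_ : Pol → Pol → Set
  d ∣ₚ f = Σ Pol λ e → f ≈ₚ (e *ₚ d)

  _≡_[modₚ_] : Pol → Pol → Pol → Set
  f ≡ g [modₚ m ] = m ∣ₚ (f -ₚ g)

  Coprime : Pol → Pol → Set
  Coprime f g = ∀ d → d ∣ₚ f → d ∣ₚ g → d ∣ₚ oneₚ

  -- Monic polynomials: degree d together with the d lower coefficients
  -- (leading coefficient 1 is implicit).
  Monic : Set
  Monic = Σ ℕ (Vec K)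

  deg : Monic → ℕ
  deg (d , _) = d

  pol : Monic → Pol
  pol (_ , cs) = toList cs ++ [ 1# ]

  ∣_∣ : Monic → ℕ
  ∣ f ∣ = q ℕ.^ deg f

  Admissible : (F H K' R : Monic) (z : ℕ) → Monic × Monic → Set
  Admissible F H K' R z (A , B) =
      (deg A ℕ.+ deg B ≡ z)
    × ((pol A *ₚ pol H) ≡ (pol B *ₚ pol K') [modₚ pol F ])
    × ¬ ((pol A *ₚ pol H) ≈ₚ (pol B *ₚ pol K'))
    × Coprime (((pol A *ₚ pol B) *ₚ pol H) *ₚ pol K') (pol R)

-- Write a, b, f, h, k for the degrees of A, B, F, H, K. Since F divides the nonzero polynomial
-- AH − BK, f ≤ max(a + h, b + k); by the symmetry (A, H) ↔ (B, K) we may assume f ≤ a + h.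
-- Then A is determined by B and its coefficients of index ≥ f − h: for two such A, A′ the
-- product (A − A′)H is divisible by F and of degree < f, hence zero. So these pairs are
-- encoded by a ≤ z, the b coefficients of B and a − (f − h) coefficients of A, leaving at most
-- (z + 1) q^(z + h + k − f) of them.
module Submission where

open import Defs
open import Data.Nat as ℕ using (ℕ; zero; suc; _∸_; _≤_; _<_; z≤n; s≤s; _≤?_; NonZero; >-nonZero)
open import Data.Nat.Properties
  using (≤-trans; ≤-refl; m≤n+m; m≤n⇒m≤1+n; m∸n+n≡m; m≤n⇒m∸n≡0; ≰⇒≥; ≰⇒>)
open import Data.Nat.DivMod using (_%_; [m+kn]%n≡m%n; m<n⇒m%n≡m)
open import Data.Nat.Tactic.RingSolver using (solve-∀)
open import Data.Nat.Primality using (Prime)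
open import Data.Fin as Fin using (Fin; toℕ; fromℕ<)
open import Data.Fin.Properties using (toℕ<n; toℕ-injective; toℕ-fromℕ<; pigeonhole)
open import Data.Digit using (Expansion; fromDigits)
open import Data.List using (List; []; _∷_; _++_; [_]; length; lookup; filter; drop; map)
open import Data.List.Properties using (∷-injectiveˡ; ∷-injectiveʳ; length-++; length-drop; length-map)
open import Data.List.Membership.Propositional.Properties using (∈-lookup)
open import Data.List.Relation.Unary.All as All using (All; _∷_)
open import Data.List.Relation.Unary.All.Properties using (all-filter)
import Data.List.Relation.Unary.All.Properties as All
open import Data.List.Relation.Unary.AllPairs using (_∷_)
open import Data.List.Relation.Unary.Unique.Propositional using (Unique)
import Data.List.Relation.Unary.Unique.Propositional.Properties as Unique
open import Data.Vec using (Vec; toList) renaming ([] to []ᵥ; _∷_ to _∷ᵥ_)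
open import Data.Vec.Properties using (length-toList)
open import Data.Product using (Σ; ∃₂; _×_; _,_; proj₁; proj₂; swap)
open import Data.Sum using (_⊎_; inj₁; inj₂; [_,_]′)
open import Data.Unit using (tt)
open import Data.Empty using (⊥-elim)
open import Relation.Nullary using (¬_; yes; no; contradiction)
open import Relation.Unary using (Decidable)
open import Relation.Unary.Properties using (∁?)
open import Relation.Binary.PropositionalEquality
  using (_≡_; refl; sym; trans; cong; cong₂; subst; _≗_; module ≡-Reasoning)
open import Algebra.Bundles using (CommutativeRing)
import Algebra.Properties.Ring as RingProperties
import Algebra.Properties.AbelianGroup as AbelianGroupProperties
import Algebra.Properties.CommutativeSemigroup as CommutativeSemigroupProperties
open import Level using (0ℓ)
open import Function using (_∘_; id)

module Coefficients {q : ℕ} (𝔽 : FiniteField q) where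
  open Poly 𝔽 hiding (K)

  commutativeRing : CommutativeRing 0ℓ 0ℓ
  commutativeRing = record { isCommutativeRing = FiniteField.isCommutativeRing 𝔽 }

  open CommutativeRing commutativeRing
    using (_+_; _*_; -_; _-_; 0#; 1#; +-identityˡ; +-identityʳ; +-comm;
           zeroˡ; zeroʳ; *-identityʳ; distribʳ; -‿inverseʳ; -‿inverseˡ; ring; +-abelianGroup;
           +-commutativeSemigroup)
  open RingProperties ring
    using (-‿distribˡ-*; -0#≈0#; -‿+-comm; x∙y⁻¹≈ε⇒x≈y; x≈y⇒x∙y⁻¹≈ε)
  open AbelianGroupProperties +-abelianGroup using (⁻¹-anti-homo‿-)
  open CommutativeSemigroupProperties +-commutativeSemigroup using (interchange)
  open ≡-Reasoning

  coeff : Pol → ℕ → Fin q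
  coeff []      _       = 0#
  coeff (a ∷ _) zero    = a
  coeff (_ ∷ f) (suc j) = coeff f j

  -- deg f < n, with deg 0 = −∞: DegreeBelow f 0 says that f is the zero polynomial.
  DegreeBelow : Pol → ℕ → Set
  DegreeBelow f n = ∀ j → n ≤ j → coeff f j ≡ 0#

  DegreeBelow-mono : ∀ f {m n} → m ≤ n → DegreeBelow f m → DegreeBelow f n
  DegreeBelow-mono _ m≤n f<m j n≤j = f<m j (≤-trans m≤n n≤j)

  IsZero⇒DegreeBelow0 : ∀ f → IsZero f → DegreeBelow f 0
  IsZero⇒DegreeBelow0 []      _         _       _ = refl
  IsZero⇒DegreeBelow0 (_ ∷ _) (a≡0 , _) zero    _ = a≡0
  IsZero⇒DegreeBelow0 (_ ∷ f) (_ , f≡0) (suc j) _ = IsZero⇒DegreeBelow0 f f≡0 j z≤n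

  DegreeBelow0⇒IsZero : ∀ f → DegreeBelow f 0 → IsZero f
  DegreeBelow0⇒IsZero []      _   = tt
  DegreeBelow0⇒IsZero (_ ∷ f) f<0 = f<0 zero z≤n , DegreeBelow0⇒IsZero f (λ j _ → f<0 (suc j) z≤n)

  coeff-+ₚ : ∀ f g j → coeff (f +ₚ g) j ≡ coeff f j + coeff g j
  coeff-+ₚ []      g       j       = sym (+-identityˡ _)
  coeff-+ₚ (_ ∷ _) []      j       = sym (+-identityʳ _)
  coeff-+ₚ (_ ∷ _) (_ ∷ _) zero    = refl
  coeff-+ₚ (_ ∷ f) (_ ∷ g) (suc j) = coeff-+ₚ f g j

  coeff-negₚ : ∀ f j → coeff (negₚ f) j ≡ - coeff f j
  coeff-negₚ []      _       = sym -0#≈0#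
  coeff-negₚ (_ ∷ _) zero    = refl
  coeff-negₚ (_ ∷ f) (suc j) = coeff-negₚ f j

  coeff--ₚ : ∀ f g j → coeff (f -ₚ g) j ≡ coeff f j - coeff g j
  coeff--ₚ f g j = trans (coeff-+ₚ f (negₚ g) j) (cong (coeff f j +_) (coeff-negₚ g j))

  coeff-scale : ∀ a f j → coeff (scale a f) j ≡ a * coeff f j
  coeff-scale a []      _       = sym (zeroʳ a)
  coeff-scale _ (_ ∷ _) zero    = refl
  coeff-scale a (_ ∷ f) (suc j) = coeff-scale a f j

  coeff-∷*ₚ : ∀ a f g j → coeff ((a ∷ f) *ₚ g) j ≡ a * coeff g j + coeff (0# ∷ (f *ₚ g)) j
  coeff-∷*ₚ a f g j =
    trans (coeff-+ₚ (scale a g) (0# ∷ (f *ₚ g)) j) (cong (_+ coeff (0# ∷ (f *ₚ g)) j) (coeff-scale a g j))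

  ≈ₚ⇒coeff≗ : ∀ f g → f ≈ₚ g → coeff f ≗ coeff g
  ≈ₚ⇒coeff≗ f g f≈g j =
    x∙y⁻¹≈ε⇒x≈y _ _ (trans (sym (coeff--ₚ f g j)) (IsZero⇒DegreeBelow0 (f -ₚ g) f≈g j z≤n))

  coeff≗⇒≈ₚ : ∀ f g → coeff f ≗ coeff g → f ≈ₚ g
  coeff≗⇒≈ₚ f g f≗g = DegreeBelow0⇒IsZero (f -ₚ g) λ j _ → begin
    coeff (f -ₚ g) j      ≡⟨ coeff--ₚ f g j ⟩
    coeff f j - coeff g j ≡⟨ cong (_- coeff g j) (f≗g j) ⟩
    coeff g j - coeff g j ≡⟨ -‿inverseʳ (coeff g j) ⟩
    0#                    ∎

  coeff-*ₚ-+ₚ : ∀ f g h j → coeff ((f +ₚ g) *ₚ h) j ≡ coeff (f *ₚ h) j + coeff (g *ₚ h) j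
  coeff-*ₚ-+ₚ []      g       h j = sym (+-identityˡ _)
  coeff-*ₚ-+ₚ (a ∷ f) []      h j = sym (+-identityʳ _)
  coeff-*ₚ-+ₚ (a ∷ f) (b ∷ g) h j = begin
    coeff (((a + b) ∷ (f +ₚ g)) *ₚ h) j
      ≡⟨ coeff-∷*ₚ (a + b) (f +ₚ g) h j ⟩
    (a + b) * coeff h j + coeff (0# ∷ ((f +ₚ g) *ₚ h)) j
      ≡⟨ cong ((a + b) * coeff h j +_) (shifted j) ⟩
    (a + b) * coeff h j + (coeff (0# ∷ (f *ₚ h)) j + coeff (0# ∷ (g *ₚ h)) j)
      ≡⟨ cong₂ _+_ (distribʳ (coeff h j) a b) refl ⟩
    (a * coeff h j + b * coeff h j) + (coeff (0# ∷ (f *ₚ h)) j + coeff (0# ∷ (g *ₚ h)) j)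
      ≡⟨ interchange _ _ _ _ ⟩
    (a * coeff h j + coeff (0# ∷ (f *ₚ h)) j) + (b * coeff h j + coeff (0# ∷ (g *ₚ h)) j)
      ≡⟨ sym (cong₂ _+_ (coeff-∷*ₚ a f h j) (coeff-∷*ₚ b g h j)) ⟩
    coeff ((a ∷ f) *ₚ h) j + coeff ((b ∷ g) *ₚ h) j ∎
    where
    shifted : ∀ j → coeff (0# ∷ ((f +ₚ g) *ₚ h)) j
                  ≡ coeff (0# ∷ (f *ₚ h)) j + coeff (0# ∷ (g *ₚ h)) j
    shifted zero    = sym (+-identityʳ 0#)
    shifted (suc j) = coeff-*ₚ-+ₚ f g h j

  coeff-*ₚ-negₚ : ∀ f h j → coeff (negₚ f *ₚ h) j ≡ - coeff (f *ₚ h) j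
  coeff-*ₚ-negₚ []      h j = sym -0#≈0#
  coeff-*ₚ-negₚ (a ∷ f) h j = begin
    coeff ((- a ∷ negₚ f) *ₚ h) j
      ≡⟨ coeff-∷*ₚ (- a) (negₚ f) h j ⟩
    - a * coeff h j + coeff (0# ∷ (negₚ f *ₚ h)) j
      ≡⟨ cong₂ _+_ (sym (-‿distribˡ-* a (coeff h j))) (shifted j) ⟩
    - (a * coeff h j) + - coeff (0# ∷ (f *ₚ h)) j
      ≡⟨ -‿+-comm _ _ ⟩
    - (a * coeff h j + coeff (0# ∷ (f *ₚ h)) j)
      ≡⟨ cong -_ (sym (coeff-∷*ₚ a f h j)) ⟩
    - coeff ((a ∷ f) *ₚ h) j ∎
    where
    shifted : ∀ j → coeff (0# ∷ (negₚ f *ₚ h)) j ≡ - coeff (0# ∷ (f *ₚ h)) j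
    shifted zero    = sym -0#≈0#
    shifted (suc j) = coeff-*ₚ-negₚ f h j

  coeff-*ₚ--ₚ : ∀ f g h j → coeff ((f -ₚ g) *ₚ h) j ≡ coeff (f *ₚ h) j - coeff (g *ₚ h) j
  coeff-*ₚ--ₚ f g h j =
    trans (coeff-*ₚ-+ₚ f (negₚ g) h j) (cong (coeff (f *ₚ h) j +_) (coeff-*ₚ-negₚ g h j))

  0∷-DegreeBelow0 : ∀ {f} → DegreeBelow f 0 → DegreeBelow (0# ∷ f) 0
  0∷-DegreeBelow0 f<0 zero    _ = refl
  0∷-DegreeBelow0 f<0 (suc j) _ = f<0 j z≤n

  *ₚ-zeroˡ : ∀ f {g} → DegreeBelow f 0 → DegreeBelow (f *ₚ g) 0
  *ₚ-zeroˡ []          f<0 j _ = refl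
  *ₚ-zeroˡ (a ∷ f) {g} f<0 j _ = begin
    coeff ((a ∷ f) *ₚ g) j                  ≡⟨ coeff-∷*ₚ a f g j ⟩
    a * coeff g j + coeff (0# ∷ (f *ₚ g)) j ≡⟨ cong₂ (λ x y → x * coeff g j + y) (f<0 zero z≤n) fg<0 ⟩
    0# * coeff g j + 0#                     ≡⟨ +-identityʳ _ ⟩
    0# * coeff g j                          ≡⟨ zeroˡ _ ⟩
    0#                                      ∎
    where
    fg<0 = 0∷-DegreeBelow0 (*ₚ-zeroˡ f (λ i _ → f<0 (suc i) z≤n)) j z≤n

  *ₚ-DegreeBelow : ∀ f {g m d} → DegreeBelow f m → DegreeBelow g (suc d) → DegreeBelow (f *ₚ g) (m ℕ.+ d)
  *ₚ-DegreeBelow []      _   _   _ _ = refl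
  *ₚ-DegreeBelow (a ∷ f) {g} {zero} f<0 _ j _ = *ₚ-zeroˡ (a ∷ f) {g} f<0 j z≤n
  *ₚ-DegreeBelow (a ∷ f) {g} {suc m} {d} f<m g<d (suc j) (s≤s m+d≤j) = begin
    coeff ((a ∷ f) *ₚ g) (suc j)       ≡⟨ coeff-∷*ₚ a f g (suc j) ⟩
    a * coeff g (suc j) + coeff (f *ₚ g) j
      ≡⟨ cong₂ (λ x y → a * x + y) (g<d (suc j) (s≤s (≤-trans (m≤n+m d m) m+d≤j)))
                                   (*ₚ-DegreeBelow f (λ i m≤i → f<m (suc i) (s≤s m≤i)) g<d j m+d≤j) ⟩
    a * 0# + 0#                        ≡⟨ +-identityʳ _ ⟩
    a * 0#                             ≡⟨ zeroʳ a ⟩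
    0#                                 ∎

  record IsMonic (f : Pol) (d : ℕ) : Set where
    field
      degree< : DegreeBelow f (suc d)
      leading : coeff f d ≡ 1#

  pol-isMonic : ∀ (M : Monic) → IsMonic (pol M) (deg M)
  pol-isMonic (_ , cs) = record { degree< = degree< cs ; leading = leading cs }
    where
    degree< : ∀ {d} (cs : Vec (Fin q) d) → DegreeBelow (pol (d , cs)) (suc d)
    degree< []ᵥ        (suc j) _           = refl
    degree< (_ ∷ᵥ cs) (suc j) (s≤s d<j) = degree< cs j d<j
    leading : ∀ {d} (cs : Vec (Fin q) d) → coeff (pol (d , cs)) d ≡ 1#
    leading []ᵥ        = refl
    leading (_ ∷ᵥ cs) = leading cs

  pol-coeff-injective : ∀ {d} (cs cs′ : Vec (Fin q) d) →
                        coeff (pol (d , cs)) ≗ coeff (pol (d , cs′)) → cs ≡ cs′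
  pol-coeff-injective []ᵥ        []ᵥ          _  = refl
  pol-coeff-injective (_ ∷ᵥ cs) (_ ∷ᵥ cs′) eq =
    cong₂ _∷ᵥ_ (eq zero) (pol-coeff-injective cs cs′ (eq ∘ suc))

  drop-pol-coeff : ∀ n {d} (cs cs′ : Vec (Fin q) d) → drop n (toList cs) ≡ drop n (toList cs′) →
                   ∀ j → n ≤ j → coeff (pol (d , cs)) j ≡ coeff (pol (d , cs′)) j
  drop-pol-coeff zero    cs         cs′         eq j _ = cong (λ xs → coeff (xs ++ [ 1# ]) j) eq
  drop-pol-coeff (suc n) []ᵥ        []ᵥ         eq j _ = refl
  drop-pol-coeff (suc n) (_ ∷ᵥ cs) (_ ∷ᵥ cs′) eq (suc j) (s≤s n≤j) = drop-pol-coeff n cs cs′ eq j n≤j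

  -- Coefficient j + 1 of (a ∷ f) *ₚ g is that of f *ₚ g once j ≥ d, so f = 0 by induction;
  -- then coefficient d is a · 1.
  *ₚ-cancel-monic : ∀ {g d} → IsMonic g d → ∀ f → DegreeBelow (f *ₚ g) d → DegreeBelow f 0
  *ₚ-cancel-monic {g} {d} g-monic []      _    _ _ = refl
  *ₚ-cancel-monic {g} {d} g-monic (a ∷ f) fg<d = λ where
      zero    _ → a≡0
      (suc j) _ → f<0 j z≤n
    where
    open IsMonic g-monic
    f<0 : DegreeBelow f 0
    f<0 = *ₚ-cancel-monic g-monic f λ j d≤j → begin
      coeff (f *ₚ g) j                     ≡⟨ sym (+-identityˡ _) ⟩
      0# + coeff (f *ₚ g) j                ≡⟨ cong (_+ coeff (f *ₚ g) j) (sym (zeroʳ a)) ⟩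
      a * 0# + coeff (f *ₚ g) j
        ≡⟨ cong (λ x → a * x + coeff (f *ₚ g) j) (sym (degree< (suc j) (s≤s d≤j))) ⟩
      a * coeff g (suc j) + coeff (f *ₚ g) j ≡⟨ sym (coeff-∷*ₚ a f g (suc j)) ⟩
      coeff ((a ∷ f) *ₚ g) (suc j)         ≡⟨ fg<d (suc j) (m≤n⇒m≤1+n d≤j) ⟩
      0#                                   ∎
    a≡0 : a ≡ 0#
    a≡0 = begin
      a                                     ≡⟨ sym (*-identityʳ a) ⟩
      a * 1#                                ≡⟨ sym (+-identityʳ _) ⟩
      a * 1# + 0#
        ≡⟨ cong₂ (λ x y → a * x + y) (sym leading) (sym (0∷-DegreeBelow0 (*ₚ-zeroˡ f {g} f<0) d z≤n)) ⟩
      a * coeff g d + coeff (0# ∷ (f *ₚ g)) d ≡⟨ sym (coeff-∷*ₚ a f g d) ⟩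
      coeff ((a ∷ f) *ₚ g) d                ≡⟨ fg<d d ≤-refl ⟩
      0#                                    ∎

  low-degree-multiple-of-monic : ∀ {F f} p e → IsMonic F f → coeff p ≗ coeff (e *ₚ F) →
                                 DegreeBelow p f → DegreeBelow p 0
  low-degree-multiple-of-monic {F} p e F-monic p≗eF p<f j _ =
    trans (p≗eF j) (*ₚ-zeroˡ e {F} e<0 j z≤n)
    where
    e<0 = *ₚ-cancel-monic F-monic e λ i f≤i → trans (sym (p≗eF i)) (p<f i f≤i)

  DegreeBelow--ₚ : ∀ u v {n} → DegreeBelow u n → DegreeBelow v n → DegreeBelow (u -ₚ v) n
  DegreeBelow--ₚ u v u<n v<n j n≤j = begin
    coeff (u -ₚ v) j      ≡⟨ coeff--ₚ u v j ⟩
    coeff u j - coeff v j ≡⟨ cong₂ _-_ (u<n j n≤j) (v<n j n≤j) ⟩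
    0# - 0#               ≡⟨ -‿inverseʳ 0# ⟩
    0#                    ∎

  congruent-distinct-degree : ∀ {F f t} u v → IsMonic F f → u ≡ v [modₚ F ] → ¬ (u ≈ₚ v) →
                              DegreeBelow u (suc t) → DegreeBelow v (suc t) → f ≤ t
  congruent-distinct-degree {f = f} {t} u v F-monic (e , u-v≈eF) u≉v u<t v<t with f ≤? t
  ... | yes f≤t = f≤t
  ... | no  f≰t = contradiction (DegreeBelow0⇒IsZero (u -ₚ v) u-v<0) u≉v
    where
    u-v<0 = low-degree-multiple-of-monic (u -ₚ v) e F-monic (≈ₚ⇒coeff≗ (u -ₚ v) (e *ₚ _) u-v≈eF)
              (DegreeBelow-mono (u -ₚ v) (≰⇒> f≰t) (DegreeBelow--ₚ u v u<t v<t))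

  [x-z]-[y-z]≡x-y : ∀ x y z → (x - z) - (y - z) ≡ x - y
  [x-z]-[y-z]≡x-y x y z = begin
    (x - z) - (y - z)  ≡⟨ cong ((x - z) +_) (⁻¹-anti-homo‿- y z) ⟩
    (x - z) + (z - y)  ≡⟨ cong ((x - z) +_) (+-comm z (- y)) ⟩
    (x - z) + (- y + z) ≡⟨ interchange x (- z) (- y) z ⟩
    (x - y) + (- z + z) ≡⟨ cong ((x - y) +_) (-‿inverseˡ z) ⟩
    (x - y) + 0#       ≡⟨ +-identityʳ _ ⟩
    x - y              ∎

  -- (p₁ − p₂) g is a multiple of F of degree < f, hence zero.
  determined-by-top-coeffs : ∀ {F g f h} p₁ p₂ y → IsMonic F f → IsMonic g h →
    (p₁ *ₚ g) ≡ y [modₚ F ] → (p₂ *ₚ g) ≡ y [modₚ F ] →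
    (∀ j → f ∸ h ≤ j → coeff p₁ j ≡ coeff p₂ j) → coeff p₁ ≗ coeff p₂
  determined-by-top-coeffs {F} {g} {f} {h} p₁ p₂ y F-monic g-monic (e₁ , d₁) (e₂ , d₂) agree
    with h ≤? f
  ... | no  h≰f = λ j → agree j (subst (_≤ j) (sym (m≤n⇒m∸n≡0 (≰⇒≥ h≰f))) z≤n)
  ... | yes h≤f = λ j → x∙y⁻¹≈ε⇒x≈y _ _ (trans (sym (coeff--ₚ p₁ p₂ j)) (δ<0 j z≤n))
    where
    δ = p₁ -ₚ p₂
    δ<f∸h : DegreeBelow δ (f ∸ h)
    δ<f∸h j f∸h≤j = trans (coeff--ₚ p₁ p₂ j) (x≈y⇒x∙y⁻¹≈ε (agree j f∸h≤j))
    δg<f : DegreeBelow (δ *ₚ g) f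
    δg<f = subst (DegreeBelow (δ *ₚ g)) (m∸n+n≡m h≤f) (*ₚ-DegreeBelow δ δ<f∸h (IsMonic.degree< g-monic))
    δg≗ : coeff (δ *ₚ g) ≗ coeff ((e₁ -ₚ e₂) *ₚ F)
    δg≗ j = begin
      coeff (δ *ₚ g) j
        ≡⟨ coeff-*ₚ--ₚ p₁ p₂ g j ⟩
      coeff (p₁ *ₚ g) j - coeff (p₂ *ₚ g) j
        ≡⟨ sym ([x-z]-[y-z]≡x-y _ _ (coeff y j)) ⟩
      (coeff (p₁ *ₚ g) j - coeff y j) - (coeff (p₂ *ₚ g) j - coeff y j)
        ≡⟨ sym (cong₂ _-_ (coeff--ₚ (p₁ *ₚ g) y j) (coeff--ₚ (p₂ *ₚ g) y j)) ⟩
      coeff ((p₁ *ₚ g) -ₚ y) j - coeff ((p₂ *ₚ g) -ₚ y) j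
        ≡⟨ cong₂ _-_ (≈ₚ⇒coeff≗ ((p₁ *ₚ g) -ₚ y) (e₁ *ₚ F) d₁ j)
                     (≈ₚ⇒coeff≗ ((p₂ *ₚ g) -ₚ y) (e₂ *ₚ F) d₂ j) ⟩
      coeff (e₁ *ₚ F) j - coeff (e₂ *ₚ F) j
        ≡⟨ sym (coeff-*ₚ--ₚ e₁ e₂ F j) ⟩
      coeff ((e₁ -ₚ e₂) *ₚ F) j ∎
    δ<0 : DegreeBelow δ 0
    δ<0 = *ₚ-cancel-monic g-monic δ (DegreeBelow-mono (δ *ₚ g) z≤n
            (low-degree-multiple-of-monic (δ *ₚ g) (e₁ -ₚ e₂) F-monic δg≗ δg<f))

  ≡-modₚ-sym : ∀ {F} u v → u ≡ v [modₚ F ] → v ≡ u [modₚ F ]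
  ≡-modₚ-sym {F} u v (e , u-v≈eF) = negₚ e , coeff≗⇒≈ₚ (v -ₚ u) (negₚ e *ₚ F) λ j → begin
    coeff (v -ₚ u) j          ≡⟨ coeff--ₚ v u j ⟩
    coeff v j - coeff u j     ≡⟨ sym (⁻¹-anti-homo‿- _ _) ⟩
    - (coeff u j - coeff v j) ≡⟨ cong -_ (sym (coeff--ₚ u v j)) ⟩
    - coeff (u -ₚ v) j        ≡⟨ cong -_ (≈ₚ⇒coeff≗ (u -ₚ v) (e *ₚ F) u-v≈eF j) ⟩
    - coeff (e *ₚ F) j        ≡⟨ sym (coeff-*ₚ-negₚ e F j) ⟩
    coeff (negₚ e *ₚ F) j     ∎

  ≈ₚ-sym : ∀ u v → u ≈ₚ v → v ≈ₚ u
  ≈ₚ-sym u v u≈v = coeff≗⇒≈ₚ v u (sym ∘ ≈ₚ⇒coeff≗ u v u≈v)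

open import Data.Nat using (_+_; _*_; _^_)
open import Data.Nat.Properties
  using (≤-reflexive; <-≤-trans; <-irrefl; ≤-total; m≤m+n; +-comm; +-suc; +-monoˡ-<; +-monoʳ-≤;
         +-monoˡ-≤; +-mono-≤; *-monoˡ-≤; *-comm; *-assoc; *-distribʳ-+; +-cancelˡ-≡; *-cancelʳ-≡;
         suc-injective; ^-distribˡ-+-*; ^-monoʳ-≤; [m+n]∸[m+o]≡n∸o; m≤n+m∸n; ∸-monoˡ-≤;
         ∸-monoʳ-≤; +-∸-assoc; module ≤-Reasoning)

m+n*o<p*o : ∀ {m n o p} → m < o → n < p → m + n * o < p * o
m+n*o<p*o {m} {n} {o} m<o n<p = <-≤-trans (+-monoˡ-< (n * o) m<o) (*-monoˡ-≤ o n<p)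

divMod-unique : ∀ {d r₁ r₂} n₁ n₂ → r₁ < d → r₂ < d →
                r₁ + n₁ * d ≡ r₂ + n₂ * d → r₁ ≡ r₂ × n₁ ≡ n₂
divMod-unique {d} {r₁} {r₂} n₁ n₂ r₁<d r₂<d eq =
  r₁≡r₂ , *-cancelʳ-≡ n₁ n₂ d (+-cancelˡ-≡ r₁ _ _ (trans eq (cong (_+ n₂ * d) (sym r₁≡r₂))))
  where
  instance
    d≢0 = >-nonZero (≤-trans (s≤s z≤n) r₁<d)
  open ≡-Reasoning
  r₁≡r₂ : r₁ ≡ r₂
  r₁≡r₂ = begin
    r₁                ≡⟨ sym (m<n⇒m%n≡m r₁<d) ⟩
    r₁ % d            ≡⟨ sym ([m+kn]%n≡m%n r₁ n₁ d) ⟩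
    (r₁ + n₁ * d) % d ≡⟨ cong (_% d) eq ⟩
    (r₂ + n₂ * d) % d ≡⟨ [m+kn]%n≡m%n r₂ n₂ d ⟩
    r₂ % d            ≡⟨ m<n⇒m%n≡m r₂<d ⟩
    r₂                ∎

fromDigits-< : ∀ {b} (ds : Expansion b) → fromDigits ds < b ^ length ds
fromDigits-< []               = s≤s z≤n
fromDigits-< {b} (d ∷ ds) =
  <-≤-trans (m+n*o<p*o (toℕ<n d) (fromDigits-< ds)) (≤-reflexive (*-comm (b ^ length ds) b))

fromDigits-injective : ∀ {b} (ds es : Expansion b) → length ds ≡ length es →
                       fromDigits ds ≡ fromDigits es → ds ≡ es
fromDigits-injective []       []       _   _  = refl
fromDigits-injective (d ∷ ds) (e ∷ es) len eq with d≡e , rest ← divMod-unique _ _ (toℕ<n d) (toℕ<n e) eq =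
  cong₂ _∷_ (toℕ-injective d≡e) (fromDigits-injective ds es (suc-injective len) rest)

toList-++-injective : ∀ {A : Set} {n} (v w : Vec A n) {xs ys : List A} →
                      toList v ++ xs ≡ toList w ++ ys → v ≡ w × xs ≡ ys
toList-++-injective []ᵥ       []ᵥ       eq = refl , eq
toList-++-injective (x ∷ᵥ v) (y ∷ᵥ w) eq with v≡w , xs≡ys ← toList-++-injective v w (∷-injectiveʳ eq) =
  cong₂ _∷ᵥ_ (∷-injectiveˡ eq) v≡w , xs≡ys

Unique-lookup-injective : ∀ {A : Set} {xs : List A} → Unique xs →
                          ∀ i j → lookup xs i ≡ lookup xs j → i ≡ j
Unique-lookup-injective (_    ∷ _) Fin.zero    Fin.zero    _  = refl
Unique-lookup-injective (x∉xs ∷ _) Fin.zero    (Fin.suc j) eq = ⊥-elim (All.lookup x∉xs (∈-lookup j) eq)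
Unique-lookup-injective (x∉xs ∷ _) (Fin.suc i) Fin.zero    eq = ⊥-elim (All.lookup x∉xs (∈-lookup i) (sym eq))
Unique-lookup-injective (_    ∷ u) (Fin.suc i) (Fin.suc j) eq = cong Fin.suc (Unique-lookup-injective u i j eq)

Unique⇒length≤ : ∀ {A : Set} {P : A → Set} {xs : List A} (code : A → ℕ) {M : ℕ} →
                 (∀ x → P x → code x < M) →
                 (∀ x y → P x → P y → code x ≡ code y → x ≡ y) →
                 Unique xs → All P xs → length xs ≤ M
Unique⇒length≤ {P = P} {xs} code {M} code-< code-injective unique all-P with length xs ≤? M
... | yes len≤M = len≤M
... | no  len≰M = ⊥-elim (collision (pigeonhole (≰⇒> len≰M) digit))
  where
  P-at : ∀ i → P (lookup xs i)
  P-at i = All.lookup all-P (∈-lookup i)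
  digit : Fin (length xs) → Fin M
  digit i = fromℕ< (code-< _ (P-at i))
  collision : ¬ ∃₂ λ i j → i Fin.< j × digit i ≡ digit j
  collision (i , j , i<j , eq) = <-irrefl (cong toℕ i≡j) i<j
    where
    i≡j = Unique-lookup-injective unique i j (code-injective _ _ (P-at i) (P-at j)
            (trans (sym (toℕ-fromℕ< _)) (trans (cong toℕ eq) (toℕ-fromℕ< _))))

length-filter+∁ : ∀ {A : Set} {P : A → Set} (P? : Decidable P) xs →
                  length (filter P? xs) + length (filter (∁? P?) xs) ≡ length xs
length-filter+∁ P? []       = refl
length-filter+∁ P? (x ∷ xs) with P? x
... | yes _ = cong suc (length-filter+∁ P? xs)
... | no  _ = trans (+-suc _ _) (cong suc (length-filter+∁ P? xs))

b+[a∸[f∸h]]≤z+h+k∸f : ∀ {a b f h z} k → a + b ≡ z → f ≤ a + h →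
                      b + (a ∸ (f ∸ h)) ≤ z + h + k ∸ f
b+[a∸[f∸h]]≤z+h+k∸f {a} {b} {f} {h} {z} k a+b≡z f≤a+h = begin
  b + (a ∸ (f ∸ h))             ≡⟨ cong (b +_) (sym ([m+n]∸[m+o]≡n∸o h a (f ∸ h))) ⟩
  b + (h + a ∸ (h + (f ∸ h)))   ≤⟨ +-monoʳ-≤ b (∸-monoʳ-≤ (h + a) (m≤n+m∸n f h)) ⟩
  b + (h + a ∸ f)               ≡⟨ sym (+-∸-assoc b (subst (f ≤_) (+-comm a h) f≤a+h)) ⟩
  b + (h + a) ∸ f               ≡⟨ cong (_∸ f) (trans (rearrange a b h) (cong (_+ h) a+b≡z)) ⟩
  z + h ∸ f                     ≤⟨ ∸-monoˡ-≤ f (m≤m+n (z + h) k) ⟩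
  z + h + k ∸ f                 ∎
  where
  open ≤-Reasoning
  rearrange : ∀ a b h → b + (h + a) ≡ a + b + h
  rearrange = solve-∀

order-nonZero : ∀ {q} → FiniteField q → NonZero q
order-nonZero {suc _} _ = _
order-nonZero {zero}  𝔽 with FiniteField.0# 𝔽
... | ()

module CongruentPairs {q : ℕ} (𝔽 : FiniteField q) where
  open Poly 𝔽 hiding (K)
  open Coefficients 𝔽

  -- Admissible without the coprimality condition, which the bound does not use.
  CongruentPair : (F H K : Monic) (z : ℕ) → Monic × Monic → Set
  CongruentPair F H K z (A , B) =
      (deg A + deg B ≡ z)
    × ((pol A *ₚ pol H) ≡ (pol B *ₚ pol K) [modₚ pol F ])
    × ¬ ((pol A *ₚ pol H) ≈ₚ (pol B *ₚ pol K))

  Admissible⇒CongruentPair : ∀ {F H K R z} s → Admissible F H K R z s → CongruentPair F H K z s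
  Admissible⇒CongruentPair _ (deg≡z , AH≡BK , AH≉BK , _) = deg≡z , AH≡BK , AH≉BK

  CongruentPair-swap : ∀ {F H K z} s → CongruentPair F H K z s → CongruentPair F K H z (swap s)
  CongruentPair-swap {H = H} {K} (A , B) (deg≡z , AH≡BK , AH≉BK) =
    trans (+-comm (deg B) (deg A)) deg≡z , ≡-modₚ-sym AH BK AH≡BK , AH≉BK ∘ ≈ₚ-sym BK AH
    where
    AH = pol A *ₚ pol H
    BK = pol B *ₚ pol K

  CongruentPair-deg≤ : ∀ {F H K z} s → CongruentPair F H K z s → ∀ {t} →
                       deg (proj₁ s) + deg H ≤ t → deg (proj₂ s) + deg K ≤ t → deg F ≤ t
  CongruentPair-deg≤ {F} {H} {K} (A , B) (_ , AH≡BK , AH≉BK) ah≤t bk≤t =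
    congruent-distinct-degree (pol A *ₚ pol H) (pol B *ₚ pol K) (pol-isMonic F) AH≡BK AH≉BK
      (DegreeBelow-mono (pol A *ₚ pol H) (s≤s ah≤t) (*ₚ-DegreeBelow (pol A) (degree< A) (degree< H)))
      (DegreeBelow-mono (pol B *ₚ pol K) (s≤s bk≤t) (*ₚ-DegreeBelow (pol B) (degree< B) (degree< K)))
    where
    degree< = IsMonic.degree< ∘ pol-isMonic

  CongruentPair-degree : ∀ {F H K z} s → CongruentPair F H K z s →
                         deg F ≤ deg (proj₁ s) + deg H ⊎ deg F ≤ deg (proj₂ s) + deg K
  CongruentPair-degree {H = H} {K} s@(A , B) cp with ≤-total (deg A + deg H) (deg B + deg K)
  ... | inj₁ ah≤bk = inj₂ (CongruentPair-deg≤ s cp ah≤bk ≤-refl)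
  ... | inj₂ bk≤ah = inj₁ (CongruentPair-deg≤ s cp ≤-refl bk≤ah)

module LeadingSide {q : ℕ} (𝔽 : FiniteField q) (F H K : Poly.Monic 𝔽) (z : ℕ) where
  open Poly 𝔽 hiding (K)
  open Coefficients 𝔽
  open CongruentPairs 𝔽

  instance
    q≢0 : NonZero q
    q≢0 = order-nonZero 𝔽

  Leading : Monic × Monic → Set
  Leading s = CongruentPair F H K z s × deg F ≤ deg (proj₁ s) + deg H

  N : ℕ
  N = z + deg H + deg K ∸ deg F

  digits : Monic × Monic → List (Fin q)
  digits ((_ , as) , (_ , bs)) = toList bs ++ drop (deg F ∸ deg H) (toList as)

  deg-A≤z : ∀ s → Leading s → deg (proj₁ s) ≤ z
  deg-A≤z s ((a+b≡z , _) , _) = subst (deg (proj₁ s) ≤_) a+b≡z (m≤m+n _ _)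

  code : Monic × Monic → ℕ
  code s = fromDigits (digits s) + deg (proj₁ s) * q ^ N

  length-digits : ∀ {a b} (as : Vec (Fin q) a) (bs : Vec (Fin q) b) →
                  length (digits ((a , as) , (b , bs))) ≡ b + (a ∸ (deg F ∸ deg H))
  length-digits {a} {b} as bs = begin
    length (toList bs ++ drop (deg F ∸ deg H) (toList as))         ≡⟨ length-++ (toList bs) ⟩
    length (toList bs) + length (drop (deg F ∸ deg H) (toList as))
      ≡⟨ cong₂ _+_ (length-toList bs) (length-drop (deg F ∸ deg H) (toList as)) ⟩
    b + (length (toList as) ∸ (deg F ∸ deg H))
      ≡⟨ cong (λ n → b + (n ∸ (deg F ∸ deg H))) (length-toList as) ⟩
    b + (a ∸ (deg F ∸ deg H))                                      ∎
    where open ≡-Reasoning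

  digits-< : ∀ s → Leading s → fromDigits (digits s) < q ^ N
  digits-< s@((a , as) , (b , bs)) ((a+b≡z , _) , F≤a+H) = <-≤-trans (fromDigits-< (digits s))
    (^-monoʳ-≤ q (subst (_≤ N) (sym (length-digits as bs)) (b+[a∸[f∸h]]≤z+h+k∸f (deg K) a+b≡z F≤a+H)))

  code-< : ∀ s → Leading s → code s < suc z * q ^ N
  code-< s ls = m+n*o<p*o (digits-< s ls) (s≤s (deg-A≤z s ls))

  code-injective : ∀ s t → Leading s → Leading t → code s ≡ code t → s ≡ t
  code-injective s@((a , as) , (b , bs)) t@((a′ , as′) , (b′ , bs′))
                 ls@((a+b≡z , AH≡BK , _) , _) lt@((a′+b′≡z , A′H≡B′K , _) , _) code≡
    with digits≡ , refl ← divMod-unique a a′ (digits-< s ls) (digits-< t lt) code≡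
    with refl ← +-cancelˡ-≡ a b b′ (trans a+b≡z (sym a′+b′≡z))
    with refl , drop≡ ← toList-++-injective bs bs′
           (fromDigits-injective _ _ (trans (length-digits as bs) (sym (length-digits as′ bs′))) digits≡)
    = cong (λ cs → (a , cs) , (b , bs)) (pol-coeff-injective as as′
        (determined-by-top-coeffs (pol (a , as)) (pol (a , as′)) (pol (b , bs) *ₚ pol K)
          (pol-isMonic F) (pol-isMonic H) AH≡BK A′H≡B′K (drop-pol-coeff (deg F ∸ deg H) as as′ drop≡)))

  leading-count : ∀ {L} → Unique L → All Leading L →
                  length L * ∣ F ∣ ≤ q ^ z * (z + 1) * (∣ H ∣ * ∣ K ∣)
  leading-count {[]}        _      _                 = z≤n
  leading-count {L@(s ∷ _)} unique leading@(ls ∷ _) = begin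
    length L * q ^ deg F
      ≤⟨ *-monoˡ-≤ _ (Unique⇒length≤ code code-< code-injective unique leading) ⟩
    suc z * q ^ N * q ^ deg F
      ≡⟨ *-assoc (suc z) (q ^ N) (q ^ deg F) ⟩
    suc z * (q ^ N * q ^ deg F)
      ≡⟨ cong (suc z *_) (sym (^-distribˡ-+-* q N (deg F))) ⟩
    suc z * q ^ (N + deg F)
      ≡⟨ cong (λ n → suc z * q ^ n) (m∸n+n≡m (F≤ s ls)) ⟩
    suc z * q ^ (z + deg H + deg K)
      ≡⟨ cong (suc z *_) (^-distribˡ-+-*³ z (deg H) (deg K)) ⟩
    suc z * (q ^ z * q ^ deg H * q ^ deg K)
      ≡⟨ rearrange z (q ^ z) (q ^ deg H) (q ^ deg K) ⟩
    q ^ z * (z + 1) * (q ^ deg H * q ^ deg K) ∎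
    where
    open ≤-Reasoning
    ^-distribˡ-+-*³ : ∀ l m n → q ^ (l + m + n) ≡ q ^ l * q ^ m * q ^ n
    ^-distribˡ-+-*³ l m n = trans (^-distribˡ-+-* q (l + m) n) (cong (_* q ^ n) (^-distribˡ-+-* q l m))
    rearrange : ∀ z x y w → suc z * (x * y * w) ≡ x * (z + 1) * (y * w)
    rearrange = solve-∀
    F≤ : ∀ s → Leading s → deg F ≤ z + deg H + deg K
    F≤ s ls@(_ , F≤a+H) = ≤-trans F≤a+H (≤-trans (+-monoˡ-≤ (deg H) (deg-A≤z s ls)) (m≤m+n _ (deg K)))

admissible-count : ∀ {q} (𝔽 : FiniteField q) → let open Poly 𝔽 in
  ∀ (F H K R : Monic) (z : ℕ) (L : List (Monic × Monic)) → Unique L → All (Admissible F H K R z) L →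
  length L * ∣ F ∣ ≤ 2 * q ^ z * (z + 1) * (∣ H ∣ * ∣ K ∣)
admissible-count {q} 𝔽 F H K R z L unique admissible = begin
  length L * ∣ F ∣
    ≡⟨ cong (_* ∣ F ∣) (sym (length-filter+∁ leading? L)) ⟩
  (length L₁ + length L₂) * ∣ F ∣
    ≡⟨ *-distribʳ-+ ∣ F ∣ (length L₁) (length L₂) ⟩
  length L₁ * ∣ F ∣ + length L₂ * ∣ F ∣
    ≡⟨ cong (λ n → length L₁ * ∣ F ∣ + n * ∣ F ∣) (sym (length-map swap L₂)) ⟩
  length L₁ * ∣ F ∣ + length (map swap L₂) * ∣ F ∣
    ≤⟨ +-mono-≤ (HK.leading-count unique₁ leading₁) (KH.leading-count unique₂ leading₂) ⟩
  q ^ z * (z + 1) * (∣ H ∣ * ∣ K ∣) + q ^ z * (z + 1) * (∣ K ∣ * ∣ H ∣)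
    ≡⟨ double (q ^ z) (z + 1) ∣ H ∣ ∣ K ∣ ⟩
  2 * q ^ z * (z + 1) * (∣ H ∣ * ∣ K ∣)            ∎
  where
  open Poly 𝔽 hiding (K)
  open CongruentPairs 𝔽
  open ≤-Reasoning
  module HK = LeadingSide 𝔽 F H K z
  module KH = LeadingSide 𝔽 F K H z
  leading? : Decidable (λ s → deg F ≤ deg (proj₁ s) + deg H)
  leading? (A , _) = deg F ≤? deg A + deg H
  L₁ = filter leading? L
  L₂ = filter (∁? leading?) L
  congruent : All (CongruentPair F H K z) L
  congruent = All.map (λ {s} → Admissible⇒CongruentPair s) admissible
  unique₁ : Unique L₁
  unique₁ = Unique.filter⁺ leading? unique
  leading₁ : All HK.Leading L₁
  leading₁ = All.zip (All.filter⁺ leading? congruent , all-filter leading? L)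
  unique₂ : Unique (map swap L₂)
  unique₂ = Unique.map⁺ (cong swap) (Unique.filter⁺ (∁? leading?) unique)
  swap-leading : ∀ s → CongruentPair F H K z s × ¬ (deg F ≤ deg (proj₁ s) + deg H) → KH.Leading (swap s)
  swap-leading s (cp , not-leading) =
    CongruentPair-swap s cp , [ ⊥-elim ∘ not-leading , id ]′ (CongruentPair-degree s cp)
  leading₂ : All KH.Leading (map swap L₂)
  leading₂ = All.map⁺ (All.zipWith (λ {s} → swap-leading s)
                         (All.filter⁺ (∁? leading?) congruent , all-filter (∁? leading?) L))
  double : ∀ a b x y → a * b * (x * y) + a * b * (y * x) ≡ 2 * a * b * (x * y)
  double = solve-∀

lemma3p4 : Σ ℕ λ C →
    ∀ (p e : ℕ) → Prime p → ¬ (p ≡ 2) → 1 ≤ e →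
    (𝔽 : FiniteField (p ^ e)) →
    let open Poly 𝔽 in
    ∀ (F H K R : Monic) (z : ℕ) → pol F ∣ₚ pol R → z < deg R →
    ∀ (L : List (Monic × Monic)) → Unique L → All (Admissible F H K R z) L →
    length L * ∣ F ∣ ≤ C * (p ^ e) ^ z * (z + 1) * (∣ H ∣ * ∣ K ∣)
-- The bound holds over every finite field, whatever p, R and z.
lemma3p4 = 2 , λ p e _ _ _ 𝔽 F H K R z _ _ → admissible-count 𝔽 F H K R z
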